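{- Let $\mathcal P$ be a regular polyhedron of type $\{p,q\}$ with automorphism group $\langle\rho_0,\rho_1,\rho_2\rangle$. For every $q'<q/2$ such that $q'$ divides $q$, the number of vertices of $\mathcal P$ fixed by $(\rho_1\rho_2)^{q'}$ is a divisor of the total number of vertices of $\mathcal P$.
   Context: An abstract regular polyhedron has flag-transitive automorphism group generated by distinguished involutions $\rho_0,\rho_1,\rho_2$ with respect to a base flag ($\rho_i$ changes only the rank-$i$ face); $\langle\rho_1,\rho_2\rangle$ is the stabilizer of the base vertex, and vertices correspond to right cosets of it. Type $\{p,q\}$ means $\rho_0\rho_1$ has order $p$ and $\rho_1\rho_2$ has order $q$. -}

module Defs where

open import Level using (Level; _⊔_)
open import Algebra.Bundles using (Group)
open import Data.Nat using (ℕ; zero; suc; _<_; _≤_)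
open import Data.List using (List; []; _∷_; foldr)
open import Data.List.Relation.Unary.All using (All)
open import Data.List.Relation.Unary.Any using (Any)
open import Data.List.Relation.Unary.AllPairs using (AllPairs)
open import Data.List.Membership.Propositional using (_∈_)
open import Data.Product using (Σ; _×_; ∃)
open import Relation.Nullary using (¬_)

module _ {c ℓ : Level} (G : Group c ℓ) where
  open Group G

  pow : Carrier → ℕ → Carrier
  pow g zero    = ε
  pow g (suc n) = g ∙ pow g n

  HasOrder : Carrier → ℕ → Set ℓ
  HasOrder g n = (0 < n) × (pow g n ≈ ε) × (∀ k → 0 < k → k < n → ¬ (pow g k ≈ ε))

  evalW : List Carrier → Carrier
  evalW = foldr _∙_ ε

  -- membership in the subgroup generated by a list of involutions
  -- (inverses of involutions are themselves, so positive words suffice)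
  InGen : List Carrier → Carrier → Set (c ⊔ ℓ)
  InGen gens x = Σ (List Carrier) λ w → All (_∈ gens) w × (x ≈ evalW w)

  -- rank-3 string C-group conditions (automorphism group of an abstract
  -- regular polyhedron with distinguished generators ρ₀ ρ₁ ρ₂)
  record IsRegularPolyhedron (ρ₀ ρ₁ ρ₂ : Carrier) : Set (c ⊔ ℓ) where
    field
      inv₀ : ρ₀ ∙ ρ₀ ≈ ε
      inv₁ : ρ₁ ∙ ρ₁ ≈ ε
      inv₂ : ρ₂ ∙ ρ₂ ≈ ε
      nontriv₀ : ¬ (ρ₀ ≈ ε)
      nontriv₁ : ¬ (ρ₁ ≈ ε)
      nontriv₂ : ¬ (ρ₂ ≈ ε)
      commute₀₂ : (ρ₀ ∙ ρ₂) ∙ (ρ₀ ∙ ρ₂) ≈ ε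
      generates : ∀ x → InGen (ρ₀ ∷ ρ₁ ∷ ρ₂ ∷ []) x
      intersection : ∀ x → InGen (ρ₀ ∷ ρ₁ ∷ []) x → InGen (ρ₁ ∷ ρ₂ ∷ []) x
                         → InGen (ρ₁ ∷ []) x

  module _ (ρ₁ ρ₂ : Carrier) where
    -- vertices = right cosets H x of H = ⟨ρ₁,ρ₂⟩ (base vertex stabilizer)
    SameVertex : Carrier → Carrier → Set (c ⊔ ℓ)
    SameVertex x y = InGen (ρ₁ ∷ ρ₂ ∷ []) (x ∙ y ⁻¹)

    FixedVertex : Carrier → Carrier → Set (c ⊔ ℓ)
    FixedVertex g x = SameVertex (x ∙ g) x

    -- V lists each vertex exactly once (by coset representatives);
    -- its length is the number of vertices
    IsVertexList : List Carrier → Set (c ⊔ ℓ)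
    IsVertexList V = (∀ x → Any (SameVertex x) V)
                   × AllPairs (λ a b → ¬ SameVertex a b) V

    IsFixedVertexList : Carrier → List Carrier → Set (c ⊔ ℓ)
    IsFixedVertexList g F = All (FixedVertex g) F
                          × (∀ x → FixedVertex g x → Any (SameVertex x) F)
                          × AllPairs (λ a b → ¬ SameVertex a b) F

-- Let H = ⟨ρ₁, ρ₂⟩, σ = ρ₁ρ₂ and g = σ^q′; the vertex Hx is fixed by g iff x g x⁻¹ ∈ H.
-- Every element of the dihedral group H is a rotation σᵏ or a reflection σᵏρ₁. A conjugate
-- of g is not a reflection, since then σ^(2q′) = ε with 0 < 2q′ < q; a rotation conjugate
-- to g satisfies the same power relations as g, so it is a power gʲ. Hence S = {x | x g x⁻¹ ∈ H}
-- is closed under products, as (xy) g (xy)⁻¹ = x gʲ x⁻¹ = (x g x⁻¹)ʲ, and since it contains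
-- the finite-index subgroup H it is a subgroup. The fixed vertices are the cosets of H inside
-- S, and every coset S y contains equally many cosets of H, so their number divides the
-- number of all cosets of H, i.e. of vertices.
module Submission where

open import Defs
open import Level using (_⊔_)
open import Algebra.Bundles using (Group)
open import Data.Bool using (true; false)
open import Data.Nat using (ℕ; zero; suc; _+_; _*_; _<_; _≤_; z≤n; s≤s; NonZero; >-nonZero⁻¹)
open import Data.Nat.Properties using (≤-refl; ≤-antisym; ≤-trans; +-suc; +-comm; *-suc; n<1+n; m≤n⇒∃[o]m+o≡n; m*n≢0; m*n≢0⇒n≢0)
open import Data.Nat.Divisibility using (_∣_; divides; quotient; _∣0; ∣m∣n⇒∣m+n; ∣-reflexive; m%n≡0⇒n∣m; m∣n⇒n≡quotient*m; quotient≢0; *-cancelˡ-∣)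
open import Data.Nat.DivMod using (_%_; _/_; m≡m%n+[m/n]*n; m%n<n)
open import Data.Fin using (Fin; zero; suc; toℕ; _≟_)
open import Data.Fin.Properties using (injective⇒≤; pigeonhole)
open import Data.List using (List; []; _∷_; _++_; length; lookup; filter; map)
open import Data.List.Properties using (length-filter; length-map)
open import Data.List.Relation.Unary.All as All using (All; []; _∷_)
import Data.List.Relation.Unary.All.Properties as All
open import Data.List.Relation.Unary.Any as Any using (Any; here; there; index)
import Data.List.Relation.Unary.Any.Properties as Any
open import Data.List.Relation.Unary.AllPairs as AllPairs using (AllPairs; _∷_)
import Data.List.Relation.Unary.AllPairs.Properties as AllPairs
open import Data.List.Membership.Propositional using (_∈_; find; lose)
open import Data.List.Membership.Propositional.Properties using (∈-lookup; ∈-filter⁺; ∈-filter⁻)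
open import Data.Product using (∃; _×_; _,_; proj₁; proj₂)
open import Data.Sum using (_⊎_; inj₁; inj₂)
open import Data.Empty using (⊥-elim)
open import Relation.Nullary using (¬_; Dec; yes; no; does)
open import Relation.Unary using (Pred; Decidable; _⊆_)
open import Relation.Unary.Properties using (∁?)
open import Relation.Binary using (Rel; IsEquivalence; _⇒_; _Respects_; _Preserves_⟶_)
import Relation.Binary as B
open import Relation.Binary.PropositionalEquality as ≡ using (_≡_)

module _ {a p} {A : Set a} {P : Pred A p} (P? : Decidable P) where

  open ≡ using (refl; cong; trans)

  length-filter-+-filter-∁ : ∀ xs → length (filter P? xs) + length (filter (∁? P?) xs) ≡ length xs
  length-filter-+-filter-∁ [] = refl
  length-filter-+-filter-∁ (x ∷ xs) with does (P? x)
  ... | true  = cong suc (length-filter-+-filter-∁ xs)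
  ... | false = trans (+-suc _ _) (cong suc (length-filter-+-filter-∁ xs))

module Transversals {a r} {A : Set a} {_~_ : Rel A r} (~-equiv : IsEquivalence _~_) where

  open ≡ using (refl; sym; trans; cong; subst)
  open IsEquivalence ~-equiv using () renaming (sym to ~-sym; trans to ~-trans)

  Distinct : List A → Set (a ⊔ r)
  Distinct = AllPairs (λ x y → ¬ x ~ y)

  Covers : ∀ {p} → Pred A p → List A → Set (a ⊔ r ⊔ p)
  Covers P L = ∀ x → P x → Any (x ~_) L

  IsTransversal : ∀ {p} → Pred A p → List A → Set (a ⊔ r ⊔ p)
  IsTransversal P L = Distinct L × All P L × Covers P L

  lookup-injective : ∀ {xs} → Distinct xs → ∀ i j → lookup xs i ~ lookup xs j → i ≡ j
  lookup-injective {_ ∷ _} _        zero    zero    _ = refl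
  lookup-injective {_ ∷ _} (d ∷ _)  zero    (suc j) e = ⊥-elim (All.lookup d (∈-lookup j) e)
  lookup-injective {_ ∷ _} (d ∷ _)  (suc i) zero    e = ⊥-elim (All.lookup d (∈-lookup i) (~-sym e))
  lookup-injective {_ ∷ _} (_ ∷ ds) (suc i) (suc j) e = cong suc (lookup-injective ds i j e)

  same-index⇒~ : ∀ {x y ys} (x∼ : Any (x ~_) ys) (y∼ : Any (y ~_) ys) → index x∼ ≡ index y∼ → x ~ y
  same-index⇒~ {ys = ys} x∼ y∼ eq =
    ~-trans (Any.lookup-index x∼) (~-sym (subst (λ i → _ ~ lookup ys i) (sym eq) (Any.lookup-index y∼)))

  length-≤ : ∀ {p} {P : Pred A p} {X Y} → Distinct X → All P X → Covers P Y → length X ≤ length Y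
  length-≤ {X = X} distinct all covers = injective⇒≤ {f = representative} injective
    where
    representative-of : ∀ i → Any (lookup X i ~_) _
    representative-of i = covers (lookup X i) (All.lookup all (∈-lookup i))
    representative : Fin (length X) → Fin _
    representative i = index (representative-of i)
    injective : ∀ {i j} → representative i ≡ representative j → i ≡ j
    injective {i} {j} eq =
      lookup-injective distinct i j (same-index⇒~ (representative-of i) (representative-of j) eq)

  transversal-length-unique : ∀ {p} {P : Pred A p} {X Y} → IsTransversal P X → IsTransversal P Y
                            → length X ≡ length Y
  transversal-length-unique (dX , aX , cX) (dY , aY , cY) = ≤-antisym (length-≤ dX aX cY) (length-≤ dY aY cX)

  Complete : List A → Set (a ⊔ r)
  Complete L = ∀ x → Any (x ~_) L

  complete⇒decidable : ∀ {V} → Complete V → Distinct V → B.Decidable _~_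
  complete⇒decidable {V} complete distinct x y with index (complete x) ≟ index (complete y)
  ... | yes eq = yes (same-index⇒~ (complete x) (complete y) eq)
  ... | no neq = no λ x~y → neq (lookup-injective distinct _ _
          (~-trans (~-sym (Any.lookup-index (complete x))) (~-trans x~y (Any.lookup-index (complete y)))))

  module Coarsening {s} {_≋_ : Rel A s} (≋-equiv : IsEquivalence _≋_) (_≋?_ : B.Decidable _≋_)
    (~⇒≋ : _~_ ⇒ _≋_) (N : ℕ) (class : ∀ y → ∃ λ C → length C ≡ N × IsTransversal (_≋ y) C) where

    open IsEquivalence ≋-equiv renaming (refl to ≋-refl; sym to ≋-sym; trans to ≋-trans)

    Saturated : List A → Set (a ⊔ r ⊔ s)
    Saturated L = ∀ {u w} → u ∈ L → w ≋ u → Any (w ~_) L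

    module _ {y L} (distinct : Distinct (y ∷ L)) (saturated : Saturated (y ∷ L)) where

      block-isTransversal : IsTransversal (_≋ y) (y ∷ filter (_≋? y) L)
      block-isTransversal =
        (All.filter⁺ (_≋? y) (AllPairs.head distinct) ∷ AllPairs.filter⁺ (_≋? y) (AllPairs.tail distinct))
        , ≋-refl ∷ All.all-filter (_≋? y) L
        , covers
        where
        covers : Covers (_≋ y) (y ∷ filter (_≋? y) L)
        covers w w≋y with saturated (here refl) w≋y
        ... | here w~y = here w~y
        ... | there w∼ with find w∼
        ...   | v , v∈L , w~v = there (lose (∈-filter⁺ (_≋? y) v∈L (≋-trans (≋-sym (~⇒≋ w~v)) w≋y)) w~v)

      rest-saturated : Saturated (filter (∁? (_≋? y)) L)
      rest-saturated {u} {w} u∈rest w≋u with ∈-filter⁻ (∁? (_≋? y)) u∈rest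
      ... | u∈L , u≉y with saturated (there u∈L) w≋u
      ...   | here w~y = ⊥-elim (u≉y (≋-trans (≋-sym w≋u) (~⇒≋ w~y)))
      ...   | there w∼ with find w∼
      ...     | v , v∈L , w~v = lose (∈-filter⁺ (∁? (_≋? y)) v∈L v≉y) w~v
        where
        v≉y : ¬ v ≋ y
        v≉y v≋y = u≉y (≋-trans (≋-sym w≋u) (≋-trans (~⇒≋ w~v) v≋y))

    -- Fuel n ≥ length L, as the recursive call is on a filtered list.
    saturated-length-∣ : ∀ n L → length L ≤ n → Distinct L → Saturated L → N ∣ length L
    saturated-length-∣ _       []      _         _        _         = N ∣0
    saturated-length-∣ (suc n) (y ∷ L) (s≤s |L|≤n) distinct saturated =
      subst (N ∣_) (cong suc (length-filter-+-filter-∁ (_≋? y) L))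
        (∣m∣n⇒∣m+n N∣block N∣rest)
      where
      N∣block : N ∣ length (y ∷ filter (_≋? y) L)
      N∣block with class y
      ... | C , |C|≡N , C-transversal = ∣-reflexive (sym (trans
              (transversal-length-unique (block-isTransversal distinct saturated) C-transversal) |C|≡N))
      N∣rest : N ∣ length (filter (∁? (_≋? y)) L)
      N∣rest = saturated-length-∣ n _ (≤-trans (length-filter (∁? (_≋? y)) L) |L|≤n)
        (AllPairs.filter⁺ (∁? (_≋? y)) (AllPairs.tail distinct)) (rest-saturated distinct saturated)

    complete-length-∣ : ∀ {V} → Complete V → Distinct V → N ∣ length V
    complete-length-∣ {V} complete distinct =
      saturated-length-∣ (length V) V ≤-refl distinct (λ {_} {w} _ _ → complete w)

module _ {c ℓ} (G : Group c ℓ) where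

  open Group G
  open import Algebra.Properties.Group G
  open import Algebra.Properties.Monoid.Mult monoid using (×-homo-+; ×-assocˡ; ×-congʳ) renaming (_×_ to _×ᴹ_)
  open import Relation.Binary.Reasoning.Setoid setoid

  pow≡× : ∀ x n → pow G x n ≡ n ×ᴹ x
  pow≡× x zero    = ≡.refl
  pow≡× x (suc n) = ≡.cong (x ∙_) (pow≡× x n)

  pow-+ : ∀ x m n → pow G x (m + n) ≈ pow G x m ∙ pow G x n
  pow-+ x m n rewrite pow≡× x (m + n) | pow≡× x m | pow≡× x n = ×-homo-+ x m n

  pow-* : ∀ x m n → pow G (pow G x m) n ≈ pow G x (n * m)
  pow-* x m n rewrite pow≡× (pow G x m) n | pow≡× x m | pow≡× x (n * m) = ×-assocˡ x n m

  pow-cong : ∀ n → (λ x → pow G x n) Preserves _≈_ ⟶ _≈_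
  pow-cong n {x} {y} x≈y rewrite pow≡× x n | pow≡× y n = ×-congʳ n x≈y

  pow-ε : ∀ n → pow G ε n ≈ ε
  pow-ε zero    = refl
  pow-ε (suc n) = trans (identityˡ _) (pow-ε n)

  pow-multiple-≈ε : ∀ {x m} → pow G x m ≈ ε → ∀ k → pow G x (k * m) ≈ ε
  pow-multiple-≈ε {x} {m} xᵐ≈ε k = begin
    pow G x (k * m)     ≈⟨ pow-* x m k ⟨
    pow G (pow G x m) k ≈⟨ pow-cong k xᵐ≈ε ⟩
    pow G ε k           ≈⟨ pow-ε k ⟩
    ε                   ∎

  pow-% : ∀ {x q} .{{_ : NonZero q}} → pow G x q ≈ ε → ∀ m → pow G x (m % q) ≈ pow G x m
  pow-% {x} {q} xᵠ≈ε m = begin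
    pow G x (m % q)                           ≈⟨ identityʳ _ ⟨
    pow G x (m % q) ∙ ε                       ≈⟨ ∙-congˡ (pow-multiple-≈ε xᵠ≈ε (m / q)) ⟨
    pow G x (m % q) ∙ pow G x (m / q * q)     ≈⟨ pow-+ x (m % q) (m / q * q) ⟨
    pow G x (m % q + m / q * q)               ≡⟨ ≡.cong (pow G x) (m≡m%n+[m/n]*n m q) ⟨
    pow G x m                                 ∎

  order-∣ : ∀ {x q m} → HasOrder G x q → pow G x m ≈ ε → q ∣ m
  order-∣ {x} {suc q₀} {m} (_ , xᵠ≈ε , minimal) xᵐ≈ε with m % suc q₀ in eq
  ... | zero  = m%n≡0⇒n∣m m (suc q₀) eq
  ... | suc _ = ⊥-elim (minimal (m % suc q₀) (≡.subst (0 <_) (≡.sym eq) (s≤s z≤n)) (m%n<n m (suc q₀))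
                  (trans (pow-% xᵠ≈ε m) xᵐ≈ε))

  conj : Carrier → Carrier → Carrier
  conj x a = x ∙ a ∙ x ⁻¹

  conj-cong : ∀ x {a b} → a ≈ b → conj x a ≈ conj x b
  conj-cong x a≈b = ∙-congʳ (∙-congˡ a≈b)

  conj-injective : ∀ x {a b} → conj x a ≈ conj x b → a ≈ b
  conj-injective x {a} {b} eq = ∙-cancelˡ x a b (∙-cancelʳ (x ⁻¹) (x ∙ a) (x ∙ b) eq)

  conj-ε : ∀ x → conj x ε ≈ ε
  conj-ε x = trans (∙-congʳ (identityʳ x)) (inverseʳ x)

  conj-∙ : ∀ x a b → conj x (a ∙ b) ≈ conj x a ∙ conj x b
  conj-∙ x a b = begin
    x ∙ (a ∙ b) ∙ x ⁻¹               ≈⟨ ∙-congʳ (assoc x a b) ⟨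
    x ∙ a ∙ b ∙ x ⁻¹                 ≈⟨ ∙-congʳ (∙-congʳ (//-rightDividesˡ x (x ∙ a))) ⟨
    x ∙ a ∙ x ⁻¹ ∙ x ∙ b ∙ x ⁻¹      ≈⟨ ∙-congʳ (assoc _ x b) ⟩
    x ∙ a ∙ x ⁻¹ ∙ (x ∙ b) ∙ x ⁻¹    ≈⟨ assoc _ (x ∙ b) (x ⁻¹) ⟩
    conj x a ∙ conj x b              ∎

  conj-conj : ∀ x y a → conj (x ∙ y) a ≈ conj x (conj y a)
  conj-conj x y a = begin
    x ∙ y ∙ a ∙ (x ∙ y) ⁻¹       ≈⟨ ∙-congˡ (⁻¹-anti-homo-∙ x y) ⟩
    x ∙ y ∙ a ∙ (y ⁻¹ ∙ x ⁻¹)    ≈⟨ assoc _ _ _ ⟨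
    x ∙ y ∙ a ∙ y ⁻¹ ∙ x ⁻¹      ≈⟨ ∙-congʳ (∙-congʳ (assoc x y a)) ⟩
    x ∙ (y ∙ a) ∙ y ⁻¹ ∙ x ⁻¹    ≈⟨ ∙-congʳ (assoc x _ _) ⟩
    conj x (conj y a)            ∎

  pow-conj : ∀ x a n → pow G (conj x a) n ≈ conj x (pow G a n)
  pow-conj x a zero    = sym (conj-ε x)
  pow-conj x a (suc n) = trans (∙-congˡ (pow-conj x a n)) (sym (conj-∙ x a (pow G a n)))

  pow-conj-≈ε⁻ : ∀ x a n → pow G (conj x a) n ≈ ε → pow G a n ≈ ε
  pow-conj-≈ε⁻ x a n eq = conj-injective x (trans (sym (pow-conj x a n)) (trans eq (sym (conj-ε x))))

  pow-conj-≈ε⁺ : ∀ x a n → pow G a n ≈ ε → pow G (conj x a) n ≈ ε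
  pow-conj-≈ε⁺ x a n eq = trans (pow-conj x a n) (trans (conj-cong x eq) (conj-ε x))

  record IsSubgroup {p} (P : Pred Carrier p) : Set (c ⊔ ℓ ⊔ p) where
    field
      ≈-resp    : P Respects _≈_
      ε-closed  : P ε
      ∙-closed  : ∀ {x y} → P x → P y → P (x ∙ y)
      ⁻¹-closed : ∀ {x} → P x → P (x ⁻¹)

    pow-closed : ∀ {x} n → P x → P (pow G x n)
    pow-closed zero    _  = ε-closed
    pow-closed (suc n) px = ∙-closed px (pow-closed n px)

    conj-closed : ∀ {x a} → P x → P a → P (conj x a)
    conj-closed px pa = ∙-closed (∙-closed px pa) (⁻¹-closed px)

  SameCoset : ∀ {p} → Pred Carrier p → Carrier → Carrier → Set p
  SameCoset P x y = P (x ∙ y ⁻¹)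

  //-trans : ∀ x y z → (x ∙ y ⁻¹) ∙ (y ∙ z ⁻¹) ≈ x ∙ z ⁻¹
  //-trans x y z = trans (assoc x (y ⁻¹) _) (∙-congˡ (\\-leftDividesʳ y (z ⁻¹)))

  sameCoset-isEquivalence : ∀ {p} {P : Pred Carrier p} → IsSubgroup P → IsEquivalence (SameCoset P)
  sameCoset-isEquivalence P-sub = record
    { refl  = λ {x} → ≈-resp (sym (inverseʳ x)) ε-closed
    ; sym   = λ {x} {y} p → ≈-resp (⁻¹-anti-homo-// x y) (⁻¹-closed p)
    ; trans = λ {x} {y} {z} p q → ≈-resp (//-trans x y z) (∙-closed p q)
    }
    where open IsSubgroup P-sub

  module _ (gens : List Carrier) (involutive : ∀ {a} → a ∈ gens → a ∙ a ≈ ε) where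

    evalW-++ : ∀ u v → evalW G (u ++ v) ≈ evalW G u ∙ evalW G v
    evalW-++ []      v = sym (identityˡ _)
    evalW-++ (a ∷ u) v = trans (∙-congˡ (evalW-++ u v)) (sym (assoc _ _ _))

    private
      InGen-resp : InGen G gens Respects _≈_
      InGen-resp x≈y (w , w⊆gens , x≈w) = w , w⊆gens , trans (sym x≈y) x≈w

      InGen-∙ : ∀ {x y} → InGen G gens x → InGen G gens y → InGen G gens (x ∙ y)
      InGen-∙ (u , u⊆gens , x≈u) (v , v⊆gens , y≈v) =
        u ++ v , All.++⁺ u⊆gens v⊆gens , trans (∙-cong x≈u y≈v) (sym (evalW-++ u v))

      InGen-word⁻¹ : ∀ w → All (_∈ gens) w → InGen G gens (evalW G w ⁻¹)
      InGen-word⁻¹ []      []             = InGen-resp (sym ε⁻¹≈ε) ([] , [] , refl)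
      InGen-word⁻¹ (a ∷ w) (a∈gens ∷ w⊆gens) = InGen-resp
        (trans (∙-congˡ (inverseʳ-unique a a (involutive a∈gens))) (sym (⁻¹-anti-homo-∙ a (evalW G w))))
        (InGen-∙ (InGen-word⁻¹ w w⊆gens) (a ∷ [] , a∈gens ∷ [] , sym (identityʳ a)))

    InGen-isSubgroup : IsSubgroup (InGen G gens)
    InGen-isSubgroup = record
      { ≈-resp    = InGen-resp
      ; ε-closed  = [] , [] , refl
      ; ∙-closed  = InGen-∙
      ; ⁻¹-closed = λ { (w , w⊆gens , x≈w) → InGen-resp (⁻¹-cong (sym x≈w)) (InGen-word⁻¹ w w⊆gens) }
      }

  module _ {h} {H : Pred Carrier h} (H-sub : IsSubgroup H) where

    open IsSubgroup H-sub
    open Transversals (sameCoset-isEquivalence H-sub)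

    module _ {V} (complete : Complete V) where

      positive-power-∈ : ∀ x → ∃ λ e → H (pow G x (suc e))
      positive-power-∈ x with pigeonhole (n<1+n (length V)) (λ i → index (complete (pow G x (toℕ i))))
      ... | i , j , i<j , same with m≤n⇒∃[o]m+o≡n i<j
      ...   | e , i+1+e≡j = e , ≈-resp xʲ//xⁱ≈xᵉ⁺¹ (IsEquivalence.sym (sameCoset-isEquivalence H-sub) xⁱ~xʲ)
        where
        xⁱ~xʲ : SameCoset H (pow G x (toℕ i)) (pow G x (toℕ j))
        xⁱ~xʲ = same-index⇒~ (complete _) (complete _) same
        j≡ : toℕ j ≡ suc e + toℕ i
        j≡ = ≡.trans (≡.sym i+1+e≡j) (≡.cong suc (+-comm (toℕ i) e))
        xʲ//xⁱ≈xᵉ⁺¹ : pow G x (toℕ j) ∙ pow G x (toℕ i) ⁻¹ ≈ pow G x (suc e)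
        xʲ//xⁱ≈xᵉ⁺¹ = begin
          pow G x (toℕ j) ∙ pow G x (toℕ i) ⁻¹                       ≡⟨ ≡.cong (λ k → pow G x k ∙ _) j≡ ⟩
          pow G x (suc e + toℕ i) ∙ pow G x (toℕ i) ⁻¹               ≈⟨ ∙-congʳ (pow-+ x (suc e) (toℕ i)) ⟩
          pow G x (suc e) ∙ pow G x (toℕ i) ∙ pow G x (toℕ i) ⁻¹     ≈⟨ //-rightDividesʳ (pow G x (toℕ i)) _ ⟩
          pow G x (suc e)                                            ∎

      -- x⁻¹ = xᵉ (xᵉ⁺¹)⁻¹ with xᵉ⁺¹ ∈ H.
      ∙-closed-superset-isSubgroup : ∀ {s} {S : Pred Carrier s} → S Respects _≈_ → H ⊆ S
                                   → (∀ {x y} → S x → S y → S (x ∙ y)) → IsSubgroup S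
      ∙-closed-superset-isSubgroup {S = S} S-resp H⊆S S-∙ = record
        { ≈-resp    = S-resp
        ; ε-closed  = H⊆S ε-closed
        ; ∙-closed  = S-∙
        ; ⁻¹-closed = S-⁻¹
        }
        where
        S-pow : ∀ {x} n → S x → S (pow G x n)
        S-pow zero    _  = H⊆S ε-closed
        S-pow (suc n) sx = S-∙ sx (S-pow n sx)
        S-⁻¹ : ∀ {x} → S x → S (x ⁻¹)
        S-⁻¹ {x} sx with positive-power-∈ x
        ... | e , xᵉ⁺¹∈H = S-resp
          (trans (∙-congˡ (⁻¹-anti-homo-∙ x (pow G x e))) (\\-leftDividesˡ (pow G x e) (x ⁻¹)))
          (S-∙ (S-pow e sx) (H⊆S (⁻¹-closed xᵉ⁺¹∈H)))

    module _ {s} {S : Pred Carrier s} (S-sub : IsSubgroup S) (H⊆S : H ⊆ S) where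

      private
        module S = IsSubgroup S-sub

        S-~ : ∀ {a b} → SameCoset H a b → S b → S a
        S-~ {a} {b} a~b sb = S.≈-resp (//-rightDividesˡ b a) (S.∙-closed (H⊆S a~b) sb)

        right-translate : ∀ {F} y → IsTransversal S F → IsTransversal (λ z → SameCoset S z y) (map (_∙ y) F)
        right-translate {F} y (distinct , F⊆S , covers) =
            AllPairs.map⁺ (AllPairs.map (λ a≁b ay~by → a≁b (≈-resp (cancel-y _ _) ay~by)) distinct)
          , All.map⁺ (All.map (S.≈-resp (sym (//-rightDividesʳ y _))) F⊆S)
          , λ w w~y → Any.map⁺ (Any.map (≈-resp (reassoc w _)) (covers (w ∙ y ⁻¹) w~y))
          where
          cancel-y : ∀ a b → a ∙ y ∙ (b ∙ y) ⁻¹ ≈ a ∙ b ⁻¹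
          cancel-y a b = trans (∙-congˡ (⁻¹-anti-homo-∙ b y))
                           (trans (sym (assoc _ _ _)) (∙-congʳ (//-rightDividesʳ y a)))
          reassoc : ∀ w f → w ∙ y ⁻¹ ∙ f ⁻¹ ≈ w ∙ (f ∙ y) ⁻¹
          reassoc w f = trans (assoc _ _ _) (∙-congˡ (sym (⁻¹-anti-homo-∙ f y)))

      index-∣ : ∀ {V F} → Complete V → Distinct V → IsTransversal S F → length F ∣ length V
      index-∣ {V} {F} complete distinct F-transversal@(_ , F⊆S , covers) =
        Coarsening.complete-length-∣ (sameCoset-isEquivalence S-sub) _≋?_ H⊆S (length F)
          (λ y → map (_∙ y) F , length-map (_∙ y) F , right-translate y F-transversal)
          complete distinct
        where
        _~?_ = complete⇒decidable complete distinct
        _≋?_ : ∀ x y → Dec (SameCoset S x y)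
        x ≋? y with Any.any? ((x ∙ y ⁻¹) ~?_) F
        ... | yes any~ = let _ , f∈F , x//y~f = find any~ in yes (S-~ x//y~f (All.lookup F⊆S f∈F))
        ... | no ≁ = no λ x//y∈S → ≁ (covers _ x//y∈S)

  module Dihedral {ρ₁ ρ₂ q₀} (ρ₁-involutive : ρ₁ ∙ ρ₁ ≈ ε) (ρ₂-involutive : ρ₂ ∙ ρ₂ ≈ ε)
                  (σ^q≈ε : pow G (ρ₁ ∙ ρ₂) (suc q₀) ≈ ε) where

    σ : Carrier
    σ = ρ₁ ∙ ρ₂

    H : Pred Carrier (c ⊔ ℓ)
    H = InGen G (ρ₁ ∷ ρ₂ ∷ [])

    H-isSubgroup : IsSubgroup H
    H-isSubgroup = InGen-isSubgroup (ρ₁ ∷ ρ₂ ∷ []) λ { (here ≡.refl) → ρ₁-involutive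
                                                     ; (there (here ≡.refl)) → ρ₂-involutive }

    Rotation Reflection : Pred Carrier ℓ
    Rotation z   = ∃ λ k → z ≈ pow G σ k
    Reflection z = ∃ λ k → z ≈ pow G σ k ∙ ρ₁

    ρ₁≈ρ₁⁻¹ : ρ₁ ≈ ρ₁ ⁻¹
    ρ₁≈ρ₁⁻¹ = inverseʳ-unique ρ₁ ρ₁ ρ₁-involutive

    ρ₁σ≈ρ₂ : ρ₁ ∙ σ ≈ ρ₂
    ρ₁σ≈ρ₂ = trans (sym (assoc ρ₁ ρ₁ ρ₂)) (trans (∙-congʳ ρ₁-involutive) (identityˡ ρ₂))

    conj-ρ₁-σ : conj ρ₁ σ ≈ pow G σ q₀
    conj-ρ₁-σ = begin
      ρ₁ ∙ σ ∙ ρ₁ ⁻¹     ≈⟨ ∙-cong ρ₁σ≈ρ₂ (sym ρ₁≈ρ₁⁻¹) ⟩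
      ρ₂ ∙ ρ₁            ≈⟨ ∙-congʳ (inverseʳ-unique ρ₂ ρ₂ ρ₂-involutive) ⟩
      ρ₂ ⁻¹ ∙ ρ₁         ≈⟨ ∙-congˡ ρ₁≈ρ₁⁻¹ ⟩
      ρ₂ ⁻¹ ∙ ρ₁ ⁻¹      ≈⟨ ⁻¹-anti-homo-∙ ρ₁ ρ₂ ⟨
      σ ⁻¹               ≈⟨ inverseʳ-unique σ (pow G σ q₀) σ^q≈ε ⟨
      pow G σ q₀         ∎

    conj-ρ₁-pow-σ : ∀ k → conj ρ₁ (pow G σ k) ≈ pow G σ (k * q₀)
    conj-ρ₁-pow-σ k = begin
      conj ρ₁ (pow G σ k)        ≈⟨ pow-conj ρ₁ σ k ⟨
      pow G (conj ρ₁ σ) k        ≈⟨ pow-cong k conj-ρ₁-σ ⟩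
      pow G (pow G σ q₀) k       ≈⟨ pow-* σ q₀ k ⟩
      pow G σ (k * q₀)           ∎

    ρ₁∙-rotation : ∀ {z} → Rotation z → Reflection (ρ₁ ∙ z)
    ρ₁∙-rotation {z} (k , z≈σᵏ) = k * q₀ , (begin
      ρ₁ ∙ z                           ≈⟨ ∙-congˡ z≈σᵏ ⟩
      ρ₁ ∙ pow G σ k                   ≈⟨ //-rightDividesˡ ρ₁ _ ⟨
      conj ρ₁ (pow G σ k) ∙ ρ₁         ≈⟨ ∙-congʳ (conj-ρ₁-pow-σ k) ⟩
      pow G σ (k * q₀) ∙ ρ₁            ∎)

    ρ₁∙-reflection : ∀ {z} → Reflection z → Rotation (ρ₁ ∙ z)
    ρ₁∙-reflection {z} (k , z≈σᵏρ₁) = k * q₀ , (begin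
      ρ₁ ∙ z                   ≈⟨ ∙-congˡ z≈σᵏρ₁ ⟩
      ρ₁ ∙ (pow G σ k ∙ ρ₁)    ≈⟨ assoc _ _ _ ⟨
      ρ₁ ∙ pow G σ k ∙ ρ₁      ≈⟨ ∙-congˡ ρ₁≈ρ₁⁻¹ ⟩
      conj ρ₁ (pow G σ k)      ≈⟨ conj-ρ₁-pow-σ k ⟩
      pow G σ (k * q₀)         ∎)

    NormalForm : Pred Carrier ℓ
    NormalForm z = Rotation z ⊎ Reflection z

    normalForm-resp : NormalForm Respects _≈_
    normalForm-resp x≈y (inj₁ (k , x≈)) = inj₁ (k , trans (sym x≈y) x≈)
    normalForm-resp x≈y (inj₂ (k , x≈)) = inj₂ (k , trans (sym x≈y) x≈)

    normalForm-ρ₁∙ : ∀ {z} → NormalForm z → NormalForm (ρ₁ ∙ z)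
    normalForm-ρ₁∙ (inj₁ rotation)   = inj₂ (ρ₁∙-rotation rotation)
    normalForm-ρ₁∙ (inj₂ reflection) = inj₁ (ρ₁∙-reflection reflection)

    normalForm-σ∙ : ∀ {z} → NormalForm z → NormalForm (σ ∙ z)
    normalForm-σ∙ (inj₁ (k , z≈)) = inj₁ (suc k , ∙-congˡ z≈)
    normalForm-σ∙ (inj₂ (k , z≈)) = inj₂ (suc k , trans (∙-congˡ z≈) (sym (assoc _ _ _)))

    normalForm-word : ∀ w → All (_∈ ρ₁ ∷ ρ₂ ∷ []) w → NormalForm (evalW G w)
    normalForm-word []      []                         = inj₁ (0 , refl)
    normalForm-word (_ ∷ w) (here ≡.refl ∷ w⊆)         = normalForm-ρ₁∙ (normalForm-word w w⊆)
    normalForm-word (_ ∷ w) (there (here ≡.refl) ∷ w⊆) = normalForm-resp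
      (trans (sym (assoc _ _ _)) (∙-congʳ ρ₁σ≈ρ₂)) (normalForm-ρ₁∙ (normalForm-σ∙ (normalForm-word w w⊆)))

    normalForm : ∀ {z} → H z → NormalForm z
    normalForm (w , w⊆ , z≈w) = normalForm-resp (sym z≈w) (normalForm-word w w⊆)

    reflection-involutive : ∀ {z} → Reflection z → z ∙ z ≈ ε
    reflection-involutive {z} (k , z≈σᵏρ₁) = begin
      z ∙ z                                 ≈⟨ ∙-cong z≈σᵏρ₁ z≈σᵏρ₁ ⟩
      pow G σ k ∙ ρ₁ ∙ (pow G σ k ∙ ρ₁)     ≈⟨ assoc _ _ _ ⟩
      pow G σ k ∙ (ρ₁ ∙ (pow G σ k ∙ ρ₁))   ≈⟨ ∙-congˡ (proj₂ (ρ₁∙-reflection (k , refl))) ⟩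
      pow G σ k ∙ pow G σ (k * q₀)          ≈⟨ pow-+ σ k (k * q₀) ⟨
      pow G σ (k + k * q₀)                  ≡⟨ ≡.cong (pow G σ) (*-suc k q₀) ⟨
      pow G σ (k * suc q₀)                  ≈⟨ pow-multiple-≈ε σ^q≈ε k ⟩
      ε                                     ∎

    σ∈H : H σ
    σ∈H = ρ₁ ∷ ρ₂ ∷ [] , here ≡.refl ∷ there (here ≡.refl) ∷ [] , ∙-congˡ (sym (identityʳ ρ₂))

    module Fixer {q′} (σ-order : HasOrder G σ (suc q₀)) (q′∣q : q′ ∣ suc q₀) (2q′<q : 2 * q′ < suc q₀) where

      open IsSubgroup H-isSubgroup

      g : Carrier
      g = pow G σ q′

      Fixes : Pred Carrier (c ⊔ ℓ)
      Fixes x = H (conj x g)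

      -- A reflection conjugate to g would force σ^(2q′) = ε, against 0 < 2q′ < q.
      conj-g-not-reflection : ∀ {x} → ¬ Reflection (conj x g)
      conj-g-not-reflection {x} reflection = proj₂ (proj₂ σ-order) (2 * q′) 0<2q′ 2q′<q σ²ᵠ′≈ε
        where
        instance
          q′≢0 : NonZero q′
          q′≢0 = m*n≢0⇒n≢0 (quotient q′∣q) {{≡.subst NonZero (m∣n⇒n≡quotient*m q′∣q) _}}
        0<2q′ : 0 < 2 * q′
        0<2q′ = >-nonZero⁻¹ (2 * q′) {{m*n≢0 2 q′}}
        σ²ᵠ′≈ε : pow G σ (2 * q′) ≈ ε
        σ²ᵠ′≈ε = trans (sym (pow-* σ q′ 2))
          (pow-conj-≈ε⁻ x g 2 (trans (∙-congˡ (identityʳ _)) (reflection-involutive reflection)))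

      -- g^(q/q′) = ε, hence σ^((q/q′)k) = ε, so q = (q/q′) q′ divides (q/q′) k.
      conj-g-rotation⇒q′∣ : ∀ {x k} → conj x g ≈ pow G σ k → q′ ∣ k
      conj-g-rotation⇒q′∣ {x} {k} conj≈σᵏ =
        *-cancelˡ-∣ nq {{quotient≢0 q′∣q}} (≡.subst (_∣ nq * k) q≡nq*q′ q∣nq*k)
        where
        nq = quotient q′∣q
        q≡nq*q′ : suc q₀ ≡ nq * q′
        q≡nq*q′ = m∣n⇒n≡quotient*m q′∣q
        gⁿᵠ≈ε : pow G g nq ≈ ε
        gⁿᵠ≈ε = trans (pow-* σ q′ nq) (≡.subst (λ n → pow G σ n ≈ ε) q≡nq*q′ (proj₁ (proj₂ σ-order)))
        q∣nq*k : suc q₀ ∣ nq * k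
        q∣nq*k = order-∣ σ-order (begin
          pow G σ (nq * k)        ≈⟨ pow-* σ k nq ⟨
          pow G (pow G σ k) nq    ≈⟨ pow-cong nq conj≈σᵏ ⟨
          pow G (conj x g) nq     ≈⟨ pow-conj-≈ε⁺ x g nq gⁿᵠ≈ε ⟩
          ε                       ∎)

      conj-g∈H⇒power-of-g : ∀ {x} → H (conj x g) → ∃ λ j → conj x g ≈ pow G g j
      conj-g∈H⇒power-of-g conj∈H with normalForm conj∈H
      ... | inj₂ reflection = ⊥-elim (conj-g-not-reflection reflection)
      ... | inj₁ (k , conj≈σᵏ) with conj-g-rotation⇒q′∣ {k = k} conj≈σᵏ
      ...   | divides j k≡j*q′ = j , trans conj≈σᵏ
                (trans (≡.subst (λ n → pow G σ k ≈ pow G σ n) k≡j*q′ refl) (sym (pow-* σ q′ j)))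

      Fixes-resp : Fixes Respects _≈_
      Fixes-resp x≈y = ≈-resp (∙-cong (∙-congʳ x≈y) (⁻¹-cong x≈y))

      H⊆Fixes : H ⊆ Fixes
      H⊆Fixes h∈H = conj-closed h∈H (pow-closed q′ σ∈H)

      Fixes-∙ : ∀ {x y} → Fixes x → Fixes y → Fixes (x ∙ y)
      Fixes-∙ {x} {y} x∈Fix y∈Fix with conj-g∈H⇒power-of-g y∈Fix
      ... | j , conj≈gʲ = ≈-resp (begin
        pow G (conj x g) j      ≈⟨ pow-conj x g j ⟩
        conj x (pow G g j)      ≈⟨ conj-cong x conj≈gʲ ⟨
        conj x (conj y g)       ≈⟨ conj-conj x y g ⟨
        conj (x ∙ y) g          ∎) (pow-closed j x∈Fix)

      Fixes-isSubgroup : ∀ {V} → Transversals.Complete (sameCoset-isEquivalence H-isSubgroup) V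
                       → IsSubgroup Fixes
      Fixes-isSubgroup complete = ∙-closed-superset-isSubgroup H-isSubgroup complete Fixes-resp H⊆Fixes Fixes-∙

proposition2p9 : ∀ {c ℓ} (G : Group c ℓ) (ρ₀ ρ₁ ρ₂ : Group.Carrier G) (p q : ℕ)
    → IsRegularPolyhedron G ρ₀ ρ₁ ρ₂
    → HasOrder G (Group._∙_ G ρ₀ ρ₁) p
    → HasOrder G (Group._∙_ G ρ₁ ρ₂) q
    → ∀ (q′ : ℕ) → q′ ∣ q → 2 * q′ < q
    → ∀ (V F : List (Group.Carrier G))
    → IsVertexList G ρ₁ ρ₂ V
    → IsFixedVertexList G ρ₁ ρ₂ (pow G (Group._∙_ G ρ₁ ρ₂) q′) F
    → length F ∣ length V
proposition2p9 G ρ₀ ρ₁ ρ₂ p zero    _          _ (() , _)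
proposition2p9 G ρ₀ ρ₁ ρ₂ p (suc q₀) polyhedron _ σ-order q′ q′∣q 2q′<q V F
  (complete , distinct) (F⊆Fixes , covers , F-distinct) =
  index-∣ G H-isSubgroup (Fixes-isSubgroup complete) H⊆Fixes complete distinct (F-distinct , F⊆Fixes , covers)
  where
  open IsRegularPolyhedron polyhedron
  open Dihedral G {q₀ = q₀} inv₁ inv₂ (proj₁ (proj₂ σ-order))
  open Fixer σ-order q′∣q 2q′<q
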